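{- Let $(\delta,K_1,K_2,C_0,C_1)$ be admissible parameters with $C'=C+1$, where $C=\min(C_0,C_1)$, $C'=\max(C_0,C_1)$. Let $\mathbf C$ be a cycle with distances $d_0,d_1,\dots,d_{2n},x_1,\dots,x_k$ with $n\ge1$ such that $\sum_{i=0}^{2n}d_i>n(C-1)+\sum_{i=1}^kx_i$. Then $\sum_{i=1}^kx_i<d_j$ for every $0\le j\le 2n$.
   Context: A $\delta$-edge-labelled cycle is a cycle graph (at least 3 vertices) with edge labels in $\{1,\dots,\delta\}$; it "has distances $d_1,\dots,d_m$" if its edges can be listed in some (arbitrary) order with these labels. Parameters: integers with $3\le\delta<\infty$, $1\le K_1\le K_2\le\delta$, $2\delta+2\le C_0,C_1\le3\delta+2$, $C_0$ even, $C_1$ odd. Admissible means either Case II: $C\le2\delta+K_1$, $C=2K_1+2K_2+1$, $K_1+K_2\ge\delta$, $K_1+2K_2\le2\delta-1$, and either $C'=C+1$ or ($C'>C+1$, $K_1=K_2$, $3K_2=2\delta-1$); or Case III: $C>2\delta+K_1$, $K_1+2K_2\ge2\delta-1$, $3K_2\ge2\delta$, if $K_1+2K_2=2\delta-1$ then $C\ge2\delta+K_1+2$, if $C'>C+1$ then $C\ge2\delta+K_2$. -}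

module Defs where

open import Data.Nat using (ℕ; suc; _+_; _*_; _∸_; _≤_; _<_; _>_; _≥_; _⊔_; _⊓_)
open import Data.Nat.Divisibility using (_∣_)
open import Data.Product using (_×_)
open import Data.Sum using (_⊎_)
open import Data.Vec using (Vec; toList; lookup)
open import Data.Fin using (Fin)
open import Data.List.Relation.Binary.Permutation.Propositional using (_↭_)
open import Relation.Nullary using (¬_)
open import Relation.Binary.PropositionalEquality using (_≡_)

record Parameters (δ K₁ K₂ C₀ C₁ : ℕ) : Set where
  field
    δ≥3   : 3 ≤ δ
    K₁≥1  : 1 ≤ K₁
    K₁≤K₂ : K₁ ≤ K₂
    K₂≤δ  : K₂ ≤ δ
    C₀-lo : 2 * δ + 2 ≤ C₀
    C₀-hi : C₀ ≤ 3 * δ + 2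
    C₁-lo : 2 * δ + 2 ≤ C₁
    C₁-hi : C₁ ≤ 3 * δ + 2
    C₀-even : 2 ∣ C₀
    C₁-odd  : ¬ (2 ∣ C₁)

Cmin : ℕ → ℕ → ℕ
Cmin C₀ C₁ = C₀ ⊓ C₁

Cmax : ℕ → ℕ → ℕ
Cmax C₀ C₁ = C₀ ⊔ C₁

CaseII : (δ K₁ K₂ C C' : ℕ) → Set
CaseII δ K₁ K₂ C C' =
  (C ≤ 2 * δ + K₁) × (C ≡ 2 * K₁ + 2 * K₂ + 1) × (K₁ + K₂ ≥ δ)
  × (K₁ + 2 * K₂ ≤ 2 * δ ∸ 1)
  × ((C' ≡ C + 1) ⊎ ((C' > C + 1) × (K₁ ≡ K₂) × (3 * K₂ ≡ 2 * δ ∸ 1)))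

CaseIII : (δ K₁ K₂ C C' : ℕ) → Set
CaseIII δ K₁ K₂ C C' =
  (C > 2 * δ + K₁) × (K₁ + 2 * K₂ ≥ 2 * δ ∸ 1) × (3 * K₂ ≥ 2 * δ)
  × ((K₁ + 2 * K₂ ≡ 2 * δ ∸ 1) → C ≥ 2 * δ + K₁ + 2)
  × ((C' > C + 1) → C ≥ 2 * δ + K₂)

Admissible : (δ K₁ K₂ C₀ C₁ : ℕ) → Set
Admissible δ K₁ K₂ C₀ C₁ =
  Parameters δ K₁ K₂ C₀ C₁ ×
  (CaseII δ K₁ K₂ (Cmin C₀ C₁) (Cmax C₀ C₁) ⊎ CaseIII δ K₁ K₂ (Cmin C₀ C₁) (Cmax C₀ C₁))

-- A δ-edge-labelled cycle: m ≥ 3 vertices 0,…,m-1, edge i joins vertex i and i+1 (mod m);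
-- the vector `label` gives the label of edge i, each in {1,…,δ}.
record EdgeLabelledCycle (δ : ℕ) : Set where
  field
    m      : ℕ
    m≥3    : 3 ≤ m
    label  : Vec ℕ m
    bounds : (i : Fin m) → 1 ≤ lookup label i × lookup label i ≤ δ

open EdgeLabelledCycle public

HasDistances : {δ : ℕ} → EdgeLabelledCycle δ → {ℓ : ℕ} → Vec ℕ ℓ → Set
HasDistances c ds = toList (label c) ↭ toList ds

-- All labels of a δ-edge-labelled cycle are at most δ, so the 2n distances other than d_j
-- contribute at most 2nδ ≤ n(C − 1) to the sum of the d_i, since C ≥ 2δ + 2.  The hypothesis
-- then leaves d_j > Σ x_i.
module Submission where

open import Defs
open import Data.Nat using (ℕ; suc; _+_; _*_; _∸_; _≤_; _<_; _>_)
open import Data.Nat.Properties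
open import Data.Fin using (Fin; zero; suc)
open import Data.Vec using (Vec; _++_; sum; lookup; _∷_)
open import Data.Vec.Relation.Unary.All using (All; []; _∷_)
open import Data.Vec.Relation.Unary.All.Properties using (lookup⁻; toList⁺; toList⁻; ++⁻)
open import Data.List.Relation.Binary.Permutation.Propositional.Properties using (All-resp-↭)
open import Data.Product using (_,_; proj₁; proj₂)
open import Function using (_∘_)
open import Relation.Binary.PropositionalEquality using (_≡_; cong)
open import Algebra.Properties.CommutativeSemigroup +-commutativeSemigroup using (x∙yz≈y∙xz)

sum-≤-* : ∀ {b m} {v : Vec ℕ m} → All (_≤ b) v → sum v ≤ m * b
sum-≤-* []         = ≤-refl
sum-≤-* (a≤b ∷ as) = +-mono-≤ a≤b (sum-≤-* as)

sum-≤-lookup+* : ∀ {b m} {v : Vec ℕ (suc m)} → All (_≤ b) v →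
                 (j : Fin (suc m)) → sum v ≤ lookup v j + m * b
sum-≤-lookup+* {v = a ∷ _} (_ ∷ as) zero = +-monoʳ-≤ a (sum-≤-* as)
sum-≤-lookup+* {b} {suc m} {a ∷ v} (a≤b ∷ as) (suc j) = begin
  a + sum v                  ≤⟨ +-mono-≤ a≤b (sum-≤-lookup+* as j) ⟩
  b + (lookup v j + m * b)   ≡⟨ x∙yz≈y∙xz b (lookup v j) (m * b) ⟩
  lookup v j + (b + m * b)   ∎
  where open ≤-Reasoning

distances-≤-δ : ∀ {δ ℓ} (c : EdgeLabelledCycle δ) {ds : Vec ℕ ℓ} →
                HasDistances c ds → All (_≤ δ) ds
distances-≤-δ c c↭ds = toList⁻ (All-resp-↭ c↭ds (toList⁺ (lookup⁻ (proj₂ ∘ bounds c))))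

2δ≤Cmin∸1 : ∀ {δ K₁ K₂ C₀ C₁} → Parameters δ K₁ K₂ C₀ C₁ → 2 * δ ≤ Cmin C₀ C₁ ∸ 1
2δ≤Cmin∸1 {δ} par = m+n≤o⇒m≤o∸n (2 * δ) (≤-trans (+-monoʳ-≤ (2 * δ) (n≤1+n 1)) (⊓-glb C₀-lo C₁-lo))
  where open Parameters par

2n*δ≤n*C : ∀ n {δ C} → 2 * δ ≤ C → 2 * n * δ ≤ n * C
2n*δ≤n*C n {δ} {C} 2δ≤C = begin
  2 * n * δ   ≡⟨ cong (_* δ) (*-comm 2 n) ⟩
  n * 2 * δ   ≡⟨ *-assoc n 2 δ ⟩
  n * (2 * δ) ≤⟨ *-monoʳ-≤ n 2δ≤C ⟩
  n * C       ∎
  where open ≤-Reasoning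

mainTheorem15 : (δ K₁ K₂ C₀ C₁ : ℕ) → Admissible δ K₁ K₂ C₀ C₁
    → Cmax C₀ C₁ ≡ Cmin C₀ C₁ + 1
    → (n k : ℕ) → 1 ≤ n
    → (d : Vec ℕ (suc (2 * n))) (x : Vec ℕ k)
    → (c : EdgeLabelledCycle δ) → HasDistances c (d ++ x)
    → sum d > n * (Cmin C₀ C₁ ∸ 1) + sum x
    → (j : Fin (suc (2 * n))) → sum x < lookup d j
mainTheorem15 δ K₁ K₂ C₀ C₁ (par , _) _ n k _ d x c c↭dx sum-d-large j =
  +-cancelʳ-< (n * C∸1) (sum x) (lookup d j) (begin-strict
    sum x + n * C∸1         ≡⟨ +-comm (sum x) (n * C∸1) ⟩
    n * C∸1 + sum x         <⟨ sum-d-large ⟩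
    sum d                   ≤⟨ sum-≤-lookup+* d≤δ j ⟩
    lookup d j + 2 * n * δ  ≤⟨ +-monoʳ-≤ (lookup d j) (2n*δ≤n*C n (2δ≤Cmin∸1 par)) ⟩
    lookup d j + n * C∸1    ∎)
  where
  open ≤-Reasoning
  C∸1 : ℕ
  C∸1 = Cmin C₀ C₁ ∸ 1
  d≤δ : All (_≤ δ) d
  d≤δ = proj₁ (++⁻ d (distances-≤-δ c c↭dx))
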